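{- For every natural number $n\geq 2$, \[ \varphi^3(n)\big(\psi(n)+\sigma(n)\big)+\psi^3(n)\big(\varphi(n)+\sigma(n)\big)+\sigma^3(n)\big(\varphi(n)+\psi(n)\big)\geq 6n^4+8n^3+12n^2+8n-2. \]
   Context: For a natural number $n$, $\varphi(n)$ is Euler's totient function (the number of positive integers not exceeding $n$ that are coprime to $n$). For $n=p_1^{a_1}\cdots p_k^{a_k}$ (distinct primes $p_i$, $a_i\geq1$), the Dedekind function is $\psi(n)=\prod_{i=1}^k p_i^{a_i-1}(p_i+1)$, with $\psi(1)=1$. $\sigma(n)$ denotes the sum of the positive divisors of $n$. -}

module Defs where

open import Data.Nat using (ℕ; zero; suc; _+_; _*_; _∸_; _^_; _≤_)
open import Data.Nat.GCD using (gcd)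
open import Data.Nat.Divisibility using (_∣?_)
open import Data.Nat.Primality using (prime?)
open import Data.Nat.Properties using (_≟_)
open import Data.List using (List; filter; map; upTo)
open import Data.Nat.ListAction using (sum; product)
open import Relation.Nullary.Decidable using (_×-dec_)

range1 : ℕ → List ℕ
range1 n = map suc (upTo n)

φ : ℕ → ℕ
φ n = Data.List.length (filter (λ k → gcd k n ≟ 1) (range1 n))

σ : ℕ → ℕ
σ n = sum (filter (λ d → d ∣? n) (range1 n))

-- p-adic valuation for n ≥ 1: the largest k ≤ n with p ^ k ∣ n
-- (exponents k ≤ n suffice since p ≥ 2 gives p ^ k > n for k > n)
val : ℕ → ℕ → ℕ
val p n = Data.List.length (filter (λ k → (p ^ k) ∣? n) (range1 n))

ψ : ℕ → ℕ
ψ n = product (map (λ p → p ^ (val p n ∸ 1) * (p + 1))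
                   (filter (λ p → prime? p ×-dec (p ∣? n)) (range1 n)))

-- φ(n) + σ(n) ≥ 2n, since every k ≤ n not coprime to n is a multiple of n/d for some
-- proper divisor d of n, and [1, n] holds d such multiples; ψ(n) > n, since n ≤ ∏ p^v_p(n)
-- while ψ replaces each factor p^v by the larger p^(v−1)(p+1). The symmetric cubic form is
-- monotone, so given φ(n) = x < n it is smallest at ψ = n + 1, σ = 2n − x, where it equals
-- the quartic minus 2 plus a polynomial with nonnegative coefficients in x and n − 1 − x.
module Submission where

open import Defs
open import Data.Nat
open import Data.Nat.Properties
open import Data.Nat.Induction using (<-wellFounded)
open import Data.Nat.Divisibility
open import Data.Nat.GCD using (gcd; gcd[m,n]∣m; gcd[m,n]∣n; gcd-greatest; gcd[m,n]≡0⇒n≡0)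
open import Data.Nat.Primality using (Prime; prime?; prime⇒nonTrivial)
open import Data.Nat.Primality.Factorisation using (factorise)
open import Data.Nat.ListAction using (sum; product)
open import Data.Nat.ListAction.Properties using (sum-++)
open import Data.Nat.Solver using (module +-*-Solver)
open +-*-Solver using (solve; _:+_; _:*_; _:^_; _:=_; con)
open import Data.List using (List; []; _∷_; _++_; [_]; filter; map; upTo; length)
open import Data.List.Properties
  using (length-++; map-++; map-id; upTo-∷ʳ; length-map; length-upTo; length-filter; filter-++; filter-accept; filter-reject; filter-all)
open import Data.List.Membership.Propositional using (_∈_)
open import Data.List.Membership.Propositional.Properties using (∈-filter⁻; ∈-filter⁺; ∈-map⁻; ∈-map⁺; ∈-upTo⁺; ∈-upTo⁻)
open import Data.List.Relation.Unary.Any using (here; there)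
import Data.List.Relation.Unary.All as All
open import Data.Product using (_,_; ∃; _×_; proj₁; proj₂; uncurry)
open import Function using (_∘_)
open import Induction.WellFounded using (Acc; acc)
open import Level using (0ℓ)
open import Relation.Nullary using (¬_; yes; no; contradiction)
open import Relation.Nullary.Decidable using (_×-dec_)
open import Relation.Unary using (Pred; Decidable)
open import Relation.Unary.Properties using (∁?)
open import Relation.Binary.PropositionalEquality using (_≡_; _≢_; refl; sym; trans; cong; subst; module ≡-Reasoning)

module _ {f g : ℕ → ℕ} where

  sum-map-mono : ∀ xs → (∀ {x} → x ∈ xs → f x ≤ g x) → sum (map f xs) ≤ sum (map g xs)
  sum-map-mono [] _ = z≤n
  sum-map-mono (x ∷ xs) f≤g = +-mono-≤ (f≤g (here refl)) (sum-map-mono xs (f≤g ∘ there))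

  sum-map-mono-< : ∀ {xs y} → y ∈ xs → f y < g y → (∀ {x} → f x ≤ g x) → sum (map f xs) < sum (map g xs)
  sum-map-mono-< {_ ∷ xs} (here refl) fy<gy f≤g = +-mono-<-≤ fy<gy (sum-map-mono xs (λ _ → f≤g))
  sum-map-mono-< (there y∈xs) fy<gy f≤g = +-mono-≤-< f≤g (sum-map-mono-< y∈xs fy<gy f≤g)

product-map-pos : ∀ {f : ℕ → ℕ} xs → (∀ {x} → x ∈ xs → 0 < f x) → 0 < product (map f xs)
product-map-pos [] _ = z<s
product-map-pos (x ∷ xs) f>0 = *-mono-≤ (f>0 (here refl)) (product-map-pos xs (f>0 ∘ there))

module _ {f g : ℕ → ℕ} where

  product-map-mono : ∀ xs → (∀ {x} → x ∈ xs → f x ≤ g x) → product (map f xs) ≤ product (map g xs)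
  product-map-mono [] _ = ≤-refl
  product-map-mono (x ∷ xs) f≤g = *-mono-≤ (f≤g (here refl)) (product-map-mono xs (f≤g ∘ there))

  product-map-mono-< : ∀ {xs y} → y ∈ xs → (∀ {x} → x ∈ xs → f x < g x) → product (map f xs) < product (map g xs)
  product-map-mono-< {x ∷ xs} (here refl) f<g = begin-strict
    f x * product (map f xs)  ≤⟨ *-monoʳ-≤ (f x) (product-map-mono xs (<⇒≤ ∘ f<g ∘ there)) ⟩
    f x * product (map g xs)  <⟨ *-monoˡ-< (product (map g xs)) {{>-nonZero ∏g>0}} (f<g (here refl)) ⟩
    g x * product (map g xs)  ∎
    where
    open ≤-Reasoning
    ∏g>0 : 0 < product (map g xs)
    ∏g>0 = product-map-pos xs (<-≤-trans z<s ∘ f<g ∘ there)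
  product-map-mono-< {x ∷ xs} (there y∈xs) f<g = begin-strict
    f x * product (map f xs)  ≤⟨ *-monoˡ-≤ (product (map f xs)) (<⇒≤ (f<g (here refl))) ⟩
    g x * product (map f xs)  <⟨ *-monoʳ-< (g x) {{>-nonZero (<-≤-trans z<s (f<g (here refl)))}} (product-map-mono-< y∈xs (f<g ∘ there)) ⟩
    g x * product (map g xs)  ∎
    where open ≤-Reasoning

module _ {P : Pred ℕ 0ℓ} (P? : Decidable P) where

  length-filter-∷-≤ : ∀ x xs → length (filter P? xs) ≤ length (filter P? (x ∷ xs))
  length-filter-∷-≤ x xs with P? x
  ... | yes _ = n≤1+n _
  ... | no _ = ≤-refl

  length-filter-∷-< : ∀ {x xs} → P x → length (filter P? xs) < length (filter P? (x ∷ xs))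
  length-filter-∷-< px = ≤-reflexive (sym (cong length (filter-accept P? px)))

  length-filter-∁ : ∀ xs → length (filter P? xs) + length (filter (∁? P?) xs) ≡ length xs
  length-filter-∁ [] = refl
  length-filter-∁ (x ∷ xs) with P? x
  ... | yes _ = cong suc (length-filter-∁ xs)
  ... | no _ = trans (+-suc _ _) (cong suc (length-filter-∁ xs))

module _ {P : Pred ℕ 0ℓ} (P? : Decidable P) where

  union-bound : ∀ {Q : ℕ → Pred ℕ 0ℓ} (Q? : ∀ e → Decidable (Q e)) es xs →
    (∀ {x} → x ∈ xs → P x → ∃ λ e → e ∈ es × Q e x) →
    length (filter P? xs) ≤ sum (map (λ e → length (filter (Q? e) xs)) es)
  union-bound Q? es [] _ = z≤n
  union-bound Q? es (x ∷ xs) cover with P? x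
  ... | no _ = ≤-trans (union-bound Q? es xs (cover ∘ there))
                       (sum-map-mono es (λ {e} _ → length-filter-∷-≤ (Q? e) x xs))
  ... | yes px with cover (here refl) px
  ... | e , e∈es , qex = ≤-trans (s≤s (union-bound Q? es xs (cover ∘ there)))
                           (sum-map-mono-< {f = λ e → length (filter (Q? e) xs)} e∈es
                              (length-filter-∷-< (Q? e) qex) (λ {e} → length-filter-∷-≤ (Q? e) x xs))

range1-suc : ∀ n → range1 (suc n) ≡ range1 n ++ [ suc n ]
range1-suc n = trans (cong (map suc) (sym (upTo-∷ʳ n))) (map-++ suc (upTo n) [ n ])

length-range1 : ∀ n → length (range1 n) ≡ n
length-range1 n = trans (length-map suc (upTo n)) (length-upTo n)

∈-range1⁺ : ∀ {k n} → 1 ≤ k → k ≤ n → k ∈ range1 n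
∈-range1⁺ {suc k} _ k<n = ∈-map⁺ suc (∈-upTo⁺ k<n)

∈-range1⁻ : ∀ {k n} → k ∈ range1 n → 1 ≤ k × k ≤ n
∈-range1⁻ k∈ with ∈-map⁻ suc k∈
... | _ , j∈ , refl = s≤s z≤n , ∈-upTo⁻ j∈

count : {P : Pred ℕ 0ℓ} → Decidable P → ℕ → ℕ
count P? n = length (filter P? (range1 n))

module _ {P : Pred ℕ 0ℓ} (P? : Decidable P) where

  count-suc : ∀ n → count P? (suc n) ≡ count P? n + length (filter P? [ suc n ])
  count-suc n = trans (cong (length ∘ filter P?) (range1-suc n))
    (trans (cong length (filter-++ P? (range1 n) [ suc n ])) (length-++ (filter P? (range1 n))))

  count-suc-accept : ∀ {n} → P (suc n) → count P? (suc n) ≡ suc (count P? n)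
  count-suc-accept {n} p =
    trans (count-suc n) (trans (cong (λ l → count P? n + length l) (filter-accept P? p)) (+-comm _ 1))

  count-suc-reject : ∀ {n} → ¬ P (suc n) → count P? (suc n) ≡ count P? n
  count-suc-reject {n} ¬p =
    trans (count-suc n) (trans (cong (λ l → count P? n + length l) (filter-reject P? ¬p)) (+-identityʳ _))

  count-≤ : ∀ n → count P? n ≤ n
  count-≤ n = ≤-trans (length-filter P? (range1 n)) (≤-reflexive (length-range1 n))

  count-mono : ∀ {m n} → m ≤ n → count P? m ≤ count P? n
  count-mono m≤n = go (≤⇒≤′ m≤n)
    where
    go : ∀ {m n} → m ≤′ n → count P? m ≤ count P? n
    go ≤′-refl = ≤-refl
    go {n = suc n} (≤′-step m≤′n) =
      ≤-trans (go m≤′n) (≤-trans (m≤m+n (count P? n) _) (≤-reflexive (sym (count-suc n))))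

  count-complement : ∀ n → count P? n + count (∁? P?) n ≡ n
  count-complement n = trans (length-filter-∁ P? (range1 n)) (length-range1 n)

  count-all : ∀ {n} → (∀ {k} → 1 ≤ k → k ≤ n → P k) → count P? n ≡ n
  count-all {n} all =
    trans (cong length (filter-all P? (All.tabulate (uncurry all ∘ ∈-range1⁻)))) (length-range1 n)

  count-multiples : ∀ {q} → (∀ {k} → P k → q ∣ k) → ∀ n → q * count P? n ≤ n
  count-multiples {q} _ zero = ≤-reflexive (*-zeroʳ q)
  count-multiples {q} P⇒q∣ (suc n) with P? (suc n)
  ... | no ¬p = begin
    q * count P? (suc n)  ≡⟨ cong (q *_) (count-suc-reject ¬p) ⟩
    q * count P? n        ≤⟨ count-multiples P⇒q∣ n ⟩
    n                     ≤⟨ n≤1+n n ⟩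
    suc n                 ∎
    where open ≤-Reasoning
  ... | yes p with P⇒q∣ p
  ... | divides j 1+n≡j*q = begin
    q * count P? (suc n)  ≡⟨ cong (q *_) (count-suc-accept p) ⟩
    q * suc (count P? n)  ≤⟨ *-monoʳ-≤ q count<j ⟩
    q * j                 ≡⟨ trans (*-comm q j) (sym 1+n≡j*q) ⟩
    suc n                 ∎
    where
    open ≤-Reasoning
    count<j : count P? n < j
    count<j = *-cancelˡ-< q (count P? n) j (begin-strict
      q * count P? n  ≤⟨ count-multiples P⇒q∣ n ⟩
      n               <⟨ n<1+n n ⟩
      suc n           ≡⟨ trans 1+n≡j*q (*-comm j q) ⟩
      q * j           ∎)

prime>1 : ∀ {p} → Prime p → 1 < p
prime>1 {p} pr = nonTrivial⇒n>1 p {{prime⇒nonTrivial pr}}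

∃-prime-divisor : ∀ {m} → 1 < m → ∃ λ p → Prime p × p ∣ m
∃-prime-divisor {m@(suc _)} m>1 with factorise m
... | record { factors = [] ; isFactorisation = m≡1 } = contradiction m≡1 (>⇒≢ m>1)
... | record { factors = p ∷ ps ; isFactorisation = m≡p*∏ps ; factorsPrime = pr All.∷ _ } =
  p , pr , divides (product ps) (trans m≡p*∏ps (*-comm p (product ps)))

n<m^n : ∀ {m} → 1 < m → ∀ n → n < m ^ n
n<m^n _ zero = z<s
n<m^n {m@(suc _)} m>1 (suc n) = begin-strict
  suc n          ≤⟨ n<m^n m>1 n ⟩
  m ^ n          <⟨ m<m+n (m ^ n) (m^n>0 m n) ⟩
  m ^ n + m ^ n  ≡⟨ cong (m ^ n +_) (+-identityʳ (m ^ n)) ⟨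
  2 * m ^ n      ≤⟨ *-monoˡ-≤ (m ^ n) m>1 ⟩
  m * m ^ n      ∎
  where open ≤-Reasoning

^-monoʳ-∣ : ∀ p {a b} → a ≤ b → p ^ a ∣ p ^ b
^-monoʳ-∣ p {a} {b} a≤b = divides (p ^ (b ∸ a)) (begin
  p ^ b                ≡⟨ cong (p ^_) (m+[n∸m]≡n a≤b) ⟨
  p ^ (a + (b ∸ a))    ≡⟨ ^-distribˡ-+-* p a (b ∸ a) ⟩
  p ^ a * p ^ (b ∸ a)  ≡⟨ *-comm (p ^ a) _ ⟩
  p ^ (b ∸ a) * p ^ a  ∎)
  where open ≡-Reasoning

m^n<m^[n∸1]*[m+1] : ∀ {m} → 0 < m → ∀ n → m ^ n < m ^ (n ∸ 1) * (m + 1)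
m^n<m^[n∸1]*[m+1] {m} m>0 zero = begin-strict
  1            <⟨ s≤s m>0 ⟩
  1 + m        ≡⟨ +-comm 1 m ⟩
  m + 1        ≡⟨ *-identityˡ (m + 1) ⟨
  1 * (m + 1)  ∎
  where open ≤-Reasoning
m^n<m^[n∸1]*[m+1] {m@(suc _)} _ (suc n) = begin-strict
  m * m ^ n          <⟨ m<m+n (m * m ^ n) (m^n>0 m n) ⟩
  m * m ^ n + m ^ n  ≡⟨ trans (+-comm _ (m ^ n)) (cong (m ^ n +_) (*-comm m (m ^ n))) ⟩
  m ^ n + m ^ n * m  ≡⟨ *-suc (m ^ n) m ⟨
  m ^ n * suc m      ≡⟨ cong (m ^ n *_) (+-comm 1 m) ⟩
  m ^ n * (m + 1)    ∎
  where open ≤-Reasoning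

split-prime-power : ∀ {q} → 1 < q → ∀ m .{{_ : NonZero m}} → ∃ λ a → ∃ λ m′ → m ≡ q ^ a * m′ × ¬ q ∣ m′
split-prime-power {q} q>1 m = go m (<-wellFounded m)
  where
  instance
    q-nonTrivial : NonTrivial q
    q-nonTrivial = n>1⇒nonTrivial q>1
  go : ∀ m .{{_ : NonZero m}} → Acc _<_ m → ∃ λ a → ∃ λ m′ → m ≡ q ^ a * m′ × ¬ q ∣ m′
  go m (acc rec) with q ∣? m
  ... | no q∤m = 0 , m , sym (*-identityˡ m) , q∤m
  ... | yes q∣m@(divides c m≡c*q) with go c {{quotient≢0 q∣m}} (rec (quotient-< q∣m))
  ... | a , m′ , c≡q^a*m′ , q∤m′ = suc a , m′ , m≡q^[1+a]*m′ , q∤m′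
    where
    open ≡-Reasoning
    m≡q^[1+a]*m′ : m ≡ q ^ suc a * m′
    m≡q^[1+a]*m′ = begin
      m                 ≡⟨ m≡c*q ⟩
      c * q             ≡⟨ cong (_* q) c≡q^a*m′ ⟩
      q ^ a * m′ * q    ≡⟨ *-comm (q ^ a * m′) q ⟩
      q * (q ^ a * m′)  ≡⟨ *-assoc q (q ^ a) m′ ⟨
      q ^ suc a * m′    ∎

∣-product-of-prime-powers : ∀ (e : ℕ → ℕ) ps {m} .{{_ : NonZero m}} →
  (∀ {p} → Prime p → p ∣ m → p ∈ ps) →
  (∀ {p k} → Prime p → p ^ k ∣ m → k ≤ e p) →
  m ∣ product (map (λ p → p ^ e p) ps)
∣-product-of-prime-powers e [] {1} _ _ = 1∣ 1
∣-product-of-prime-powers e [] {2+ m} primes∈[] _ with ∃-prime-divisor {2+ m} (s≤s (s≤s z≤n))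
... | p , pr , p∣m with primes∈[] pr p∣m
... | ()
∣-product-of-prime-powers e (q ∷ ps) {m} primes∈ exps≤ with prime? q
... | no ¬prime = ∣-trans (∣-product-of-prime-powers e ps primes∈ps exps≤) (n∣m*n (q ^ e q))
  where
  primes∈ps : ∀ {p} → Prime p → p ∣ m → p ∈ ps
  primes∈ps pr p∣m with primes∈ pr p∣m
  ... | here refl = contradiction pr ¬prime
  ... | there p∈ps = p∈ps
... | yes q-prime with split-prime-power (prime>1 q-prime) m
... | a , m′ , m≡q^a*m′ , q∤m′ = subst (_∣ q ^ e q * _) (sym m≡q^a*m′) (*-pres-∣ q^a∣q^e m′∣rest)
  where
  q^a∣q^e : q ^ a ∣ q ^ e q
  q^a∣q^e = ^-monoʳ-∣ q (exps≤ {k = a} q-prime (subst (q ^ a ∣_) (sym m≡q^a*m′) (m∣m*n m′)))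
  m′∣m : m′ ∣ m
  m′∣m = divides (q ^ a) m≡q^a*m′
  instance
    m′≢0 : NonZero m′
    m′≢0 = ≢-nonZero λ { refl → ≢-nonZero⁻¹ m (trans m≡q^a*m′ (*-zeroʳ (q ^ a))) }
  primes∈ps : ∀ {p} → Prime p → p ∣ m′ → p ∈ ps
  primes∈ps pr p∣m′ with primes∈ pr (∣-trans p∣m′ m′∣m)
  ... | here refl = contradiction p∣m′ q∤m′
  ... | there p∈ps = p∈ps
  m′∣rest : m′ ∣ product (map (λ p → p ^ e p) ps)
  m′∣rest = ∣-product-of-prime-powers e ps primes∈ps (λ pr p^k∣m′ → exps≤ pr (∣-trans p^k∣m′ m′∣m))

φ<n : ∀ {n} → 1 < n → φ n < n
φ<n {suc m} (s≤s m>0) = begin-strict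
  φ (suc m)                          ≡⟨ count-suc-reject (λ k → gcd k (suc m) ≟ 1) gcd[n,n]≢1 ⟩
  count (λ k → gcd k (suc m) ≟ 1) m  ≤⟨ count-≤ _ m ⟩
  m                                  <⟨ n<1+n m ⟩
  suc m                              ∎
  where
  open ≤-Reasoning
  gcd[n,n]≢1 : gcd (suc m) (suc m) ≢ 1
  gcd[n,n]≢1 eq = <⇒≢ (s≤s m>0) (sym (∣1⇒≡1 (subst (suc m ∣_) eq (gcd-greatest ∣-refl ∣-refl))))

properDivisors : ℕ → List ℕ
properDivisors n = filter (_∣? n) (range1 (pred n))

σ≡sum-properDivisors+n : ∀ n → σ n ≡ sum (properDivisors n) + n
σ≡sum-properDivisors+n zero = refl
σ≡sum-properDivisors+n n@(suc m) = begin
  sum (filter (_∣? n) (range1 (suc m)))           ≡⟨ cong (sum ∘ filter (_∣? n)) (range1-suc m) ⟩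
  sum (filter (_∣? n) (range1 m ++ [ n ]))        ≡⟨ cong sum (filter-++ (_∣? n) (range1 m) [ n ]) ⟩
  sum (properDivisors n ++ filter (_∣? n) [ n ])  ≡⟨ cong (sum ∘ (properDivisors n ++_)) (filter-accept (_∣? n) ∣-refl) ⟩
  sum (properDivisors n ++ [ n ])                 ≡⟨ sum-++ (properDivisors n) [ n ] ⟩
  sum (properDivisors n) + (n + 0)                ≡⟨ cong (sum (properDivisors n) +_) (+-identityʳ n) ⟩
  sum (properDivisors n) + n                      ∎
  where open ≡-Reasoning

-- n ∣ d * k says that k is a multiple of n/d, without dividing.
noncoprime-cover : ∀ {n k} → k ∈ range1 n → gcd k n ≢ 1 → ∃ λ d → d ∈ properDivisors n × n ∣ d * k
noncoprime-cover {n} {k} k∈ gcd≢1 with gcd[m,n]∣n k n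
... | g∣n@(divides d n≡d*g) =
  d , ∈-filter⁺ (_∣? n) (∈-range1⁺ (>-nonZero⁻¹ d) (<⇒≤pred (quotient-< g∣n))) (quotient-∣ g∣n) , n∣d*k
  where
  instance
    n≢0 : NonZero n
    n≢0 = >-nonZero (≤-trans (proj₁ (∈-range1⁻ k∈)) (proj₂ (∈-range1⁻ k∈)))
    d≢0 : NonZero d
    d≢0 = quotient≢0 g∣n
    g-nonTrivial : NonTrivial (gcd k n)
    g-nonTrivial = n>1⇒nonTrivial (≤∧≢⇒< (n≢0⇒n>0 (≢-nonZero⁻¹ n ∘ gcd[m,n]≡0⇒n≡0 k)) (gcd≢1 ∘ sym))
  n∣d*k : n ∣ d * k
  n∣d*k = subst (_∣ d * k) (sym n≡d*g) (*-monoʳ-∣ d (gcd[m,n]∣m k n))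

count-multiples-of-cofactor : ∀ {n d} → d ∈ properDivisors n → count (λ k → n ∣? d * k) n ≤ d
count-multiples-of-cofactor {n} {d} d∈ with ∈-filter⁻ (_∣? n) {xs = range1 (pred n)} d∈
... | d∈range , d∣n@(divides q n≡q*d) = *-cancelˡ-≤ q (begin
  q * count (λ k → n ∣? d * k) n  ≤⟨ count-multiples (λ k → n ∣? d * k) n∣dk⇒q∣k n ⟩
  n                               ≡⟨ n≡q*d ⟩
  q * d                           ∎)
  where
  open ≤-Reasoning
  instance
    d≢0 : NonZero d
    d≢0 = >-nonZero (proj₁ (∈-range1⁻ d∈range))
    n≢0 : NonZero n
    n≢0 = >-nonZero (≤-trans (proj₁ (∈-range1⁻ d∈range)) (≤pred⇒≤ (proj₂ (∈-range1⁻ d∈range))))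
    q≢0 : NonZero q
    q≢0 = quotient≢0 d∣n
  n∣dk⇒q∣k : ∀ {k} → n ∣ d * k → q ∣ k
  n∣dk⇒q∣k {k} n∣dk = *-cancelˡ-∣ d (subst (_∣ d * k) (trans n≡q*d (*-comm q d)) n∣dk)

n+n≤φ+σ : ∀ n → n + n ≤ φ n + σ n
n+n≤φ+σ n = begin
  n + n                               ≡⟨ cong (_+ n) (count-complement coprime? n) ⟨
  φ n + count (∁? coprime?) n + n     ≤⟨ +-monoˡ-≤ n (+-monoʳ-≤ (φ n) noncoprime≤sum) ⟩
  φ n + sum (properDivisors n) + n    ≡⟨ +-assoc (φ n) _ n ⟩
  φ n + (sum (properDivisors n) + n)  ≡⟨ cong (φ n +_) (σ≡sum-properDivisors+n n) ⟨
  φ n + σ n                           ∎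
  where
  open ≤-Reasoning
  coprime? : Decidable (λ k → gcd k n ≡ 1)
  coprime? k = gcd k n ≟ 1
  noncoprime≤sum : count (∁? coprime?) n ≤ sum (properDivisors n)
  noncoprime≤sum = begin
    count (∁? coprime?) n
      ≤⟨ union-bound (∁? coprime?) (λ d k → n ∣? d * k) (properDivisors n) (range1 n) noncoprime-cover ⟩
    sum (map (λ d → count (λ k → n ∣? d * k) n) (properDivisors n))
      ≤⟨ sum-map-mono (properDivisors n) (count-multiples-of-cofactor {n}) ⟩
    sum (map (λ d → d) (properDivisors n))
      ≡⟨ cong sum (map-id (properDivisors n)) ⟩
    sum (properDivisors n)
      ∎

≤-val : ∀ {p k n} .{{_ : NonZero n}} → Prime p → p ^ k ∣ n → k ≤ val p n
≤-val {p} {k} {n} pr p^k∣n = begin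
  k                           ≡⟨ count-all (λ j → p ^ j ∣? n) (λ _ j≤k → ∣-trans (^-monoʳ-∣ p j≤k) p^k∣n) ⟨
  count (λ j → p ^ j ∣? n) k  ≤⟨ count-mono (λ j → p ^ j ∣? n) k≤n ⟩
  val p n                     ∎
  where
  open ≤-Reasoning
  k≤n : k ≤ n
  k≤n = <⇒≤ (<-≤-trans (n<m^n (prime>1 pr) k) (∣⇒≤ p^k∣n))

n<ψ : ∀ {n} → 1 < n → n < ψ n
n<ψ {n} n>1 with ∃-prime-divisor n>1
... | q , q-prime , q∣n = begin-strict
  n                                     ≤⟨ ∣⇒≤ {{>-nonZero ∏p^v>0}} n∣∏p^v ⟩
  product (map (λ p → p ^ val p n) ps)  <⟨ product-map-mono-< (prime-divisor∈ps q-prime q∣n) p^v<ψ-factor ⟩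
  ψ n                                   ∎
  where
  open ≤-Reasoning
  instance
    n≢0 : NonZero n
    n≢0 = >-nonZero (<-trans z<s n>1)
  ps : List ℕ
  ps = filter (λ p → prime? p ×-dec (p ∣? n)) (range1 n)
  prime-divisor∈ps : ∀ {p} → Prime p → p ∣ n → p ∈ ps
  prime-divisor∈ps pr p∣n =
    ∈-filter⁺ (λ p → prime? p ×-dec (p ∣? n)) (∈-range1⁺ (<⇒≤ (prime>1 pr)) (∣⇒≤ p∣n)) (pr , p∣n)
  ps-pos : ∀ {p} → p ∈ ps → 0 < p
  ps-pos p∈ = proj₁ (∈-range1⁻ (proj₁ (∈-filter⁻ (λ p → prime? p ×-dec (p ∣? n)) {xs = range1 n} p∈)))
  p^v<ψ-factor : ∀ {p} → p ∈ ps → p ^ val p n < p ^ (val p n ∸ 1) * (p + 1)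
  p^v<ψ-factor {p} p∈ = m^n<m^[n∸1]*[m+1] (ps-pos p∈) (val p n)
  ∏p^v>0 : 0 < product (map (λ p → p ^ val p n) ps)
  ∏p^v>0 = product-map-pos ps (λ {p} p∈ → m^n>0 p {{>-nonZero (ps-pos p∈)}} (val p n))
  n∣∏p^v : n ∣ product (map (λ p → p ^ val p n) ps)
  n∣∏p^v = ∣-product-of-prime-powers (λ p → val p n) ps prime-divisor∈ps ≤-val

symmetricCubicSum : ℕ → ℕ → ℕ → ℕ
symmetricCubicSum x y z = x ^ 3 * (y + z) + y ^ 3 * (x + z) + z ^ 3 * (x + y)

symmetricCubicSum-mono : ∀ {x x′ y y′ z z′} → x ≤ x′ → y ≤ y′ → z ≤ z′ →
  symmetricCubicSum x y z ≤ symmetricCubicSum x′ y′ z′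
symmetricCubicSum-mono x≤ y≤ z≤ =
  +-mono-≤ (+-mono-≤ (*-mono-≤ (^-monoˡ-≤ 3 x≤) (+-mono-≤ y≤ z≤))
                     (*-mono-≤ (^-monoˡ-≤ 3 y≤) (+-mono-≤ x≤ z≤)))
           (*-mono-≤ (^-monoˡ-≤ 3 z≤) (+-mono-≤ x≤ y≤))

-- The slack vanishes exactly when s = 0, i.e. x = n − 1 (n prime): the bound is sharp.
symmetricCubicSum-extremal : ∀ x s → let n = suc x + s in
  2 + symmetricCubicSum x (suc n) (x + 2 * s + 2) ≡
    6 * n ^ 4 + 8 * n ^ 3 + 12 * n ^ 2 + 8 * n
    + s * (s + 2) * (6 * x * x + 12 * x * s + 18 * x + 4 * s * s + 14 * s + 8)
symmetricCubicSum-extremal = solve 2 (λ x s →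
  let n = con 1 :+ x :+ s ; y = con 2 :+ x :+ s ; z = x :+ con 2 :* s :+ con 2 in
  con 2 :+ (x :^ 3 :* (y :+ z) :+ y :^ 3 :* (x :+ z) :+ z :^ 3 :* (x :+ y)) :=
  con 6 :* n :^ 4 :+ con 8 :* n :^ 3 :+ con 12 :* n :^ 2 :+ con 8 :* n
  :+ s :* (s :+ con 2) :* (con 6 :* x :* x :+ con 12 :* x :* s :+ con 18 :* x :+ con 4 :* s :* s :+ con 14 :* s :+ con 8)) refl

quartic≤symmetricCubicSum : ∀ {n x y z} → x < n → n < y → n + n ≤ x + z →
  6 * n ^ 4 + 8 * n ^ 3 + 12 * n ^ 2 + 8 * n ∸ 2 ≤ symmetricCubicSum x y z
quartic≤symmetricCubicSum {x = x} {y} {z} x<n n<y n+n≤x+z with m≤n⇒∃[o]m+o≡n x<n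
... | s , refl = m≤n+o⇒m∸n≤o _ 2 (≤-trans (m≤m+n _ slack)
      (≤-trans (≤-reflexive (sym (symmetricCubicSum-extremal x s)))
               (+-monoʳ-≤ 2 (symmetricCubicSum-mono ≤-refl n<y z₀≤z))))
  where
  slack : ℕ
  slack = s * (s + 2) * (6 * x * x + 12 * x * s + 18 * x + 4 * s * s + 14 * s + 8)
  n+n≡x+z₀ : ∀ x s → suc x + s + (suc x + s) ≡ x + (x + 2 * s + 2)
  n+n≡x+z₀ = solve 2 (λ x s → (con 1 :+ x :+ s) :+ (con 1 :+ x :+ s) := x :+ (x :+ con 2 :* s :+ con 2)) refl
  z₀≤z : x + 2 * s + 2 ≤ z
  z₀≤z = +-cancelˡ-≤ x _ _ (subst (_≤ x + z) (n+n≡x+z₀ x s) n+n≤x+z)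

theorem5 : (n : ℕ) → 2 ≤ n →
    6 * n ^ 4 + 8 * n ^ 3 + 12 * n ^ 2 + 8 * n ∸ 2
      ≤ φ n ^ 3 * (ψ n + σ n) + ψ n ^ 3 * (φ n + σ n) + σ n ^ 3 * (φ n + ψ n)
theorem5 n n≥2 = quartic≤symmetricCubicSum (φ<n n≥2) (n<ψ n≥2) (n+n≤φ+σ n)
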